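{- If $T$ is a coherent pseudotree $T$ of uncountable cofinality, no suborder of $T$ is isomorphic to $(2^{\leq\omega},\subset)$.
   Context: A pseudotree is a partial order $T$ such that each strict lower cone $\downarrow x=\{y : y<_T x\}$ is a chain. A pseudotree $T$ is functional if there is a linear order $L$ such that $T$ is a downward closed suborder of the class of all functions with domains of the form $\downarrow x=\{y : y<_L x\}$, ordered by inclusion; the rank $\rho\colon T\to L$ sends $t$ to the unique element with $\mathrm{dom}(t)={\downarrow\rho(t)}$. The cofinality $\mathrm{cf}(T)$ of a functional pseudotree is $\mathrm{cf}(\rho[T])$. $=^*$ denotes equality of sets modulo a finite set. A pseudotree $T$ is coherent if it is functional and $\mathrm{dom}(s)=\mathrm{dom}(t)$ implies $s=^*t$. -}

module Defs where

open import Level using (Level; _⊔_; suc)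
open import Data.Nat using (ℕ)
import Data.Nat as N
open import Data.Bool using (Bool)
open import Data.List using (List; _++_; length; lookup)
open import Data.List.Membership.Propositional using (_∉_)
open import Data.Fin using (fromℕ<)
open import Data.Product using (Σ; ∃; _×_)
open import Data.Sum using (_⊎_)
open import Relation.Nullary using (¬_)
open import Relation.Binary using (Rel)
open import Relation.Binary.PropositionalEquality using (_≡_)

-- The Cantor tree 2^{≤ω}: finite and infinite binary sequences,
-- ordered by "is an initial segment of" (⊆ as sets of pairs).
data C2 : Set where
  fin : List Bool → C2
  inf : (ℕ → Bool) → C2

_⊑_ : C2 → C2 → Set
fin l ⊑ fin m = ∃ λ k → m ≡ l ++ k
fin l ⊑ inf s = ∀ i (p : i N.< length l) → lookup l (fromℕ< p) ≡ s i
inf s ⊑ fin m = Data.Empty.⊥ where import Data.Empty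
inf s ⊑ inf t = ∀ i → s i ≡ t i

-- Functional pseudotrees over a linear order (L, <) with values in A.
module Functional {l r a : Level} {L : Set l} (_<_ : Rel L r) (A : Set a) where

  -- a function with domain ↓x = {y : y < x}; the proof argument is
  -- irrelevant, so this is literally a function on the set ↓x.
  record Node : Set (l ⊔ r ⊔ a) where
    constructor node
    field
      rank : L
      val  : (y : L) → .(y < rank) → A
  open Node public

  _≤L_ : L → L → Set (l ⊔ r)
  x ≤L y = (x < y) ⊎ Level.Lift r (x ≡ y)

  _⊆_ : Node → Node → Set (l ⊔ r ⊔ a)
  s ⊆ t = (∀ y → y < rank s → y < rank t)
        × (∀ y (p : y < rank s) (q : y < rank t) → val s y p ≡ val t y q)

  module _ {t : Level} (T : Node → Set t) where

    DownClosed : Set (l ⊔ r ⊔ a ⊔ t)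
    DownClosed = ∀ s u → s ⊆ u → T u → T s

    FinDiff : Node → Node → Set (l ⊔ r ⊔ a)
    FinDiff s u = Σ (List L) λ F →
      ∀ y (p : y < rank s) (q : y < rank u) → y ∉ F → val s y p ≡ val u y q

    Coherent : Set (l ⊔ r ⊔ a ⊔ t)
    Coherent = DownClosed
      × (∀ s u → T s → T u → rank s ≡ rank u → FinDiff s u)

    -- cf(ρ[T]) is uncountable: ρ[T] is nonempty and no countable
    -- (enumerated by ℕ) subset of ρ[T] is cofinal in ρ[T].
    UncountableCof : Set (l ⊔ r ⊔ a ⊔ t)
    UncountableCof = (∃ λ s → T s)
      × (∀ (f : ℕ → Node) → (∀ n → T (f n)) →
           ∃ λ s → T s × (∀ n → ¬ (rank s ≤L rank (f n))))

    EmbedsCantorTree : Set (l ⊔ r ⊔ a ⊔ t)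
    EmbedsCantorTree = Σ (C2 → Node) λ e →
      (∀ c → T (e c)) × (∀ c d → (c ⊑ d → e c ⊆ e d) × (e c ⊆ e d → c ⊑ d))

module Submission where

-- Uncountable cofinality gives a node s of T above the countably many images
-- e(σ) of finite sequences σ, and coherence makes the image of each branch x
-- differ from s only on a finite set F x. At a splitting node e(σ), two
-- branches through different children cannot both avoid F on the ranks added
-- by their child: otherwise both children agree with e(σ) below rank e(σ) and
-- with s above it, so they are compatible, hence comparable, which the
-- embedding forbids. So if we walk down a branch and switch to the sibling
-- whenever F of the current branch misses the next interval of ranks, then
-- F of the limit branch x meets the interval at every switch, while between switches
-- F of the current branch meets every interval. The number of points of F x
-- above the current rank, followed by that of F of the current branch, then
-- decreases lexicographically forever.

open import Defs
open import Level using (Level; _⊔_; 0ℓ; lift)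
open import Function using (_∘_)
open import Data.Bool using (Bool; true; false; not)
open import Data.Bool.Properties using (not-¬)
open import Data.Nat using (ℕ; zero; suc; z≤n; s≤s)
import Data.Nat as ℕ
import Data.Nat.Properties as ℕₚ
open import Data.Nat.Induction using (<-wellFounded)
import Data.Nat.Binary as ℕᵇ
open import Data.Nat.Binary.Properties using (fromℕ-toℕ)
open import Data.Fin.Properties using (toℕ-fromℕ<)
open import Data.List using (List; []; _∷_; _++_; [_]; _∷ʳ_; length; filter; applyUpTo)
open import Data.List.Properties
  using (++-assoc; ++-cancelˡ; ∷-injectiveˡ; applyUpTo-∷ʳ; lookup-applyUpTo)
open import Data.List.Relation.Unary.Any as Any using (Any; here; there; any?)
open import Data.List.Membership.Propositional using (_∉_)
open import Data.Product using (Σ; ∃; _×_; _,_; proj₁; proj₂)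
open import Data.Product.Relation.Binary.Lex.Strict using (×-Lex; ×-wellFounded')
open import Data.Sum using (_⊎_; inj₁; inj₂)
open import Data.Empty using (⊥)
open import Induction.WellFounded using (WellFounded)
open import Induction.InfiniteDescent
  using (InfiniteDescendingSequence; Descent; descent∧wf⇒empty)
open import Relation.Nullary using (¬_; Dec; yes; no; contradiction; ¬?)
open import Relation.Nullary.Decidable using (_×-dec_)
open import Relation.Unary using (Pred; _∩_; ∁)
import Relation.Unary as U
open import Relation.Binary using (Rel; IsStrictTotalOrder; tri<; tri≈; tri>)
open import Relation.Binary.PropositionalEquality
  using (_≡_; _≢_; refl; sym; trans; cong; cong₂; subst; module ≡-Reasoning)

wellFounded⇒noDescendingSequence : ∀ {a r} {A : Set a} {_<_ : Rel A r} →
  WellFounded _<_ → (f : ℕ → A) → ¬ InfiniteDescendingSequence _<_ f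
wellFounded⇒noDescendingSequence {_<_ = _<_} wf f f-desc =
  descent∧wf⇒empty descent wf (f 0) (0 , refl)
  where
  descent : Descent _<_ (λ x → ∃ λ n → f n ≡ x)
  descent (n , refl) = f (suc n) , f-desc n , suc n , refl

-- Lexicographic, but the first coordinate need only be non-increasing.
_<ₗₑₓ_ : Rel (ℕ × ℕ) 0ℓ
_<ₗₑₓ_ = ×-Lex ℕ._≤_ ℕ._<_ ℕ._<_

<ₗₑₓ-wellFounded : WellFounded _<ₗₑₓ_
<ₗₑₓ-wellFounded =
  ×-wellFounded' ℕₚ.≤-trans (λ y≤z x<y → ℕₚ.<-≤-trans x<y y≤z) <-wellFounded <-wellFounded

module _ {a p q} {A : Set a} {P : Pred A p} {Q : Pred A q}
         (P? : U.Decidable P) (Q? : U.Decidable Q) (P⊆Q : P U.⊆ Q) where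

  length-filter-mono : ∀ xs → length (filter P? xs) ℕ.≤ length (filter Q? xs)
  length-filter-mono [] = z≤n
  length-filter-mono (x ∷ xs) with P? x | Q? x
  ... | yes _  | yes _   = s≤s (length-filter-mono xs)
  ... | yes px | no ¬qx  = contradiction (P⊆Q px) ¬qx
  ... | no _   | yes _   = ℕₚ.m≤n⇒m≤1+n (length-filter-mono xs)
  ... | no _   | no _    = length-filter-mono xs

  length-filter-mono-< : ∀ {xs} → Any (Q ∩ ∁ P) xs →
                         length (filter P? xs) ℕ.< length (filter Q? xs)
  length-filter-mono-< {x ∷ xs} (here (qx , ¬px)) with P? x | Q? x
  ... | yes px | _       = contradiction px ¬px
  ... | no _   | yes _   = s≤s (length-filter-mono xs)
  ... | no _   | no ¬qx  = contradiction qx ¬qx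
  length-filter-mono-< {x ∷ xs} (there any) with P? x | Q? x
  ... | yes _  | yes _   = s≤s (length-filter-mono-< any)
  ... | yes px | no ¬qx  = contradiction (P⊆Q px) ¬qx
  ... | no _   | yes _   = ℕₚ.m<n⇒m<1+n (length-filter-mono-< any)
  ... | no _   | no _    = length-filter-mono-< any

AgreeBelow : ∀ {a} {A : Set a} → ℕ → (ℕ → A) → (ℕ → A) → Set a
AgreeBelow m f g = ∀ {i} → i ℕ.< m → f i ≡ g i

applyUpTo-cong : ∀ {a} {A : Set a} {m} {f g : ℕ → A} →
                 AgreeBelow m f g → applyUpTo f m ≡ applyUpTo g m
applyUpTo-cong {m = zero}  f≐g = refl
applyUpTo-cong {m = suc m} f≐g = cong₂ _∷_ (f≐g (s≤s z≤n)) (applyUpTo-cong (f≐g ∘ s≤s))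

module _ {m} {x y : ℕ → Bool} (x≐y : AgreeBelow m x y) where

  applyUpTo-suc-∷ʳ : applyUpTo y (suc m) ≡ applyUpTo x m ∷ʳ y m
  applyUpTo-suc-∷ʳ =
    trans (sym (applyUpTo-∷ʳ y m)) (cong (_∷ʳ y m) (sym (applyUpTo-cong x≐y)))

  applyUpTo-⊑-suc : fin (applyUpTo x m) ⊑ fin (applyUpTo y (suc m))
  applyUpTo-⊑-suc = [ y m ] , applyUpTo-suc-∷ʳ

  applyUpTo-suc-⋢ : x m ≢ y m → ¬ fin (applyUpTo x (suc m)) ⊑ fin (applyUpTo y (suc m))
  applyUpTo-suc-⋢ xm≢ym (k , y≡x++k) =
    xm≢ym (sym (∷-injectiveˡ (++-cancelˡ (applyUpTo x m) [ y m ] (x m ∷ k) split)))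
    where
    open ≡-Reasoning
    split : applyUpTo x m ++ [ y m ] ≡ applyUpTo x m ++ (x m ∷ k)
    split = begin
      applyUpTo x m ∷ʳ y m             ≡⟨ sym applyUpTo-suc-∷ʳ ⟩
      applyUpTo y (suc m)              ≡⟨ y≡x++k ⟩
      applyUpTo x (suc m) ++ k         ≡⟨ cong (_++ k) (sym (applyUpTo-∷ʳ x m)) ⟩
      (applyUpTo x m ∷ʳ x m) ++ k      ≡⟨ ++-assoc (applyUpTo x m) [ x m ] k ⟩
      applyUpTo x m ++ (x m ∷ k)       ∎

applyUpTo-⊑ : ∀ x m → fin (applyUpTo x m) ⊑ inf x
applyUpTo-⊑ x m i i<m = trans (lookup-applyUpTo x m _) (cong x (toℕ-fromℕ< i<m))

-- Binary numerals are exactly the finite binary sequences.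
bits : ℕᵇ.ℕᵇ → List Bool
bits ℕᵇ.zero       = []
bits ℕᵇ.2[1+ n ]   = true ∷ bits n
bits ℕᵇ.1+[2 n ]   = false ∷ bits n

fromBits : List Bool → ℕᵇ.ℕᵇ
fromBits []             = ℕᵇ.zero
fromBits (true ∷ σ) = ℕᵇ.2[1+ fromBits σ ]
fromBits (false ∷ σ)    = ℕᵇ.1+[2 fromBits σ ]

bits-fromBits : ∀ σ → bits (fromBits σ) ≡ σ
bits-fromBits []             = refl
bits-fromBits (true ∷ σ) = cong (true ∷_) (bits-fromBits σ)
bits-fromBits (false ∷ σ)    = cong (false ∷_) (bits-fromBits σ)

enumerate : ℕ → List Bool
enumerate = bits ∘ ℕᵇ.fromℕ

enumerate-surjective : ∀ σ → ∃ λ n → enumerate n ≡ σ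
enumerate-surjective σ =
  ℕᵇ.toℕ (fromBits σ) , trans (cong bits (fromℕ-toℕ (fromBits σ))) (bits-fromBits σ)

module Pseudotree {l r a} {L : Set l} {_<_ : Rel L r}
                  (sto : IsStrictTotalOrder _≡_ _<_) (A : Set a) where

  open Functional _<_ A
  open IsStrictTotalOrder sto using (compare; irrefl) renaming (trans to <-trans)

  <-≮-trans : ∀ {x y z} → x < y → ¬ z < y → x < z
  <-≮-trans {y = y} {z} x<y z≮y with compare y z
  ... | tri< y<z _ _ = <-trans x<y y<z
  ... | tri≈ _ refl _ = x<y
  ... | tri> _ _ z<y = contradiction z<y z≮y

  restrict : (u : Node) (μ : L) → (∀ {y} → y < μ → y < rank u) → Node
  restrict u μ μ≤u = node μ (λ y y<μ → val u y (μ≤u y<μ))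

  restrict-⊆ : ∀ u μ (μ≤u : ∀ {y} → y < μ → y < rank u) → restrict u μ μ≤u ⊆ u
  restrict-⊆ u μ μ≤u = (λ _ → μ≤u) , λ _ _ _ → refl

  ⊆⇒rank≮ : ∀ {s u} → s ⊆ u → ¬ rank u < rank s
  ⊆⇒rank≮ s⊆u u<s = irrefl refl (proj₁ s⊆u _ u<s)

  Compatible : Node → Node → Set (l ⊔ r ⊔ a)
  Compatible s u = ∀ y (p : y < rank s) (q : y < rank u) → val s y p ≡ val u y q

  compatible⇒comparable : ∀ {s u} → Compatible s u → s ⊆ u ⊎ u ⊆ s
  compatible⇒comparable {s} {u} s≍u with compare (rank s) (rank u)
  ... | tri< s<u _ _ = inj₁ ((λ _ p → <-trans p s<u) , s≍u)
  ... | tri≈ _ refl _ = inj₁ ((λ _ p → p) , s≍u)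
  ... | tri> _ _ u<s = inj₂ ((λ _ p → <-trans p u<s) , λ y p q → sym (s≍u y q p))

  module _ {t} (T : Node → Set t) (coh : Coherent T) where

    finDiff-sym : ∀ {s u} → FinDiff T s u → FinDiff T u s
    finDiff-sym (F , s≐u) = F , λ y p q y∉F → sym (s≐u y q p y∉F)

    finDiff-domain⊆ : ∀ {s u} → (∀ {y} → y < rank s → y < rank u) →
                      T s → T u → FinDiff T s u
    finDiff-domain⊆ {s} {u} s≤u Ts Tu = proj₁ diff , λ y p _ → proj₂ diff y p p
      where
      u′ = restrict u (rank s) s≤u
      diff : FinDiff T s u′
      diff = proj₂ coh s u′ Ts (proj₁ coh u′ u (restrict-⊆ u (rank s) s≤u) Tu) refl

    coherent⇒finDiff : ∀ {s u} → T s → T u → FinDiff T s u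
    coherent⇒finDiff {s} {u} Ts Tu with compare (rank s) (rank u)
    ... | tri< s<u _ _ = finDiff-domain⊆ (λ p → <-trans p s<u) Ts Tu
    ... | tri≈ _ refl _ = finDiff-domain⊆ (λ p → p) Ts Tu
    ... | tri> _ _ u<s = finDiff-sym (finDiff-domain⊆ (λ p → <-trans p u<s) Tu Ts)

module NoCantorSubtree {l r a t} {L : Set l} {_<_ : Rel L r}
  (sto : IsStrictTotalOrder _≡_ _<_) {A : Set a} {T : Functional.Node _<_ A → Set t}
  (coh : Functional.Coherent _<_ A T) (unc : Functional.UncountableCof _<_ A T)
  (emb : Functional.EmbedsCantorTree _<_ A T) where

  open Functional _<_ A
  open Pseudotree sto A
  open IsStrictTotalOrder sto using (compare; _<?_) renaming (trans to <-trans)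

  e : C2 → Node
  e = proj₁ emb

  e∈T : ∀ c → T (e c)
  e∈T = proj₁ (proj₂ emb)

  e-mono : ∀ {c d} → c ⊑ d → e c ⊆ e d
  e-mono = proj₁ (proj₂ (proj₂ emb) _ _)

  e-reflect : ∀ {c d} → e c ⊆ e d → c ⊑ d
  e-reflect = proj₂ (proj₂ (proj₂ emb) _ _)

  top-spec : Σ Node λ s → T s × (∀ n → ¬ (rank s ≤L rank (e (fin (enumerate n)))))
  top-spec = proj₂ unc (e ∘ fin ∘ enumerate) (e∈T ∘ fin ∘ enumerate)

  top : Node
  top = proj₁ top-spec

  top∈T : T top
  top∈T = proj₁ (proj₂ top-spec)

  fin-below-top : ∀ σ → rank (e (fin σ)) < rank top
  fin-below-top σ with enumerate-surjective σ
  ... | n , refl with compare (rank (e (fin (enumerate n)))) (rank top)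
  ...   | tri< below _ _ = below
  ...   | tri≈ _ equal _ = contradiction (inj₂ (lift (sym equal))) (proj₂ (proj₂ top-spec) n)
  ...   | tri> _ _ above = contradiction (inj₁ above) (proj₂ (proj₂ top-spec) n)

  branch-finDiff : ∀ x → FinDiff T (e (inf x)) top
  branch-finDiff x = coherent⇒finDiff T coh (e∈T (inf x)) top∈T

  Exceptions : (ℕ → Bool) → List L
  Exceptions x = proj₁ (branch-finDiff x)

  stem : (ℕ → Bool) → ℕ → Node
  stem x m = e (fin (applyUpTo x m))

  stem-⊆ : ∀ {m x y} → AgreeBelow m x y → stem x m ⊆ stem y (suc m)
  stem-⊆ x≐y = e-mono (applyUpTo-⊑-suc x≐y)

  stem-rank-mono : ∀ x m → ¬ rank (stem x (suc m)) < rank (stem x m)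
  stem-rank-mono x m = ⊆⇒rank≮ (stem-⊆ {x = x} (λ _ → refl))

  stem-agrees-with-top : ∀ x m y (p : y < rank (stem x m)) → y ∉ Exceptions x →
                         val (stem x m) y p ≡ val top y (<-trans p (fin-below-top _))
  stem-agrees-with-top x m y p y∉F =
    trans (proj₂ stem⊆branch y p (proj₁ stem⊆branch y p))
          (proj₂ (branch-finDiff x) y (proj₁ stem⊆branch y p) (<-trans p (fin-below-top _)) y∉F)
    where
    stem⊆branch = e-mono (applyUpTo-⊑ x m)

  Meets : List L → L → L → Set (l ⊔ r)
  Meets F ρ ρ′ = Any (λ y → ¬ y < ρ × y < ρ′) F

  meets? : ∀ F ρ ρ′ → Dec (Meets F ρ ρ′)
  meets? F ρ ρ′ = any? (λ y → ¬? (y <? ρ) ×-dec (y <? ρ′)) F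

  ¬Meets⇒∉ : ∀ {F ρ ρ′ y} → ¬ Meets F ρ ρ′ → ¬ y < ρ → y < ρ′ → y ∉ F
  ¬Meets⇒∉ ¬meets y≮ρ y<ρ′ y∈F = ¬meets (Any.map (λ { refl → y≮ρ , y<ρ′ }) y∈F)

  countFrom : List L → L → ℕ
  countFrom F ρ = length (filter (λ y → ¬? (y <? ρ)) F)

  countFrom-antitone : ∀ F {ρ ρ′} → ¬ ρ′ < ρ → countFrom F ρ′ ℕ.≤ countFrom F ρ
  countFrom-antitone F ρ′≮ρ =
    length-filter-mono _ _ (λ y≮ρ′ y<ρ → y≮ρ′ (<-≮-trans y<ρ ρ′≮ρ)) F

  countFrom-decreasing : ∀ F {ρ ρ′} → ¬ ρ′ < ρ → Meets F ρ ρ′ →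
                         countFrom F ρ′ ℕ.< countFrom F ρ
  countFrom-decreasing F ρ′≮ρ meets =
    length-filter-mono-< _ _ (λ y≮ρ′ y<ρ → y≮ρ′ (<-≮-trans y<ρ ρ′≮ρ))
      (Any.map (λ (y≮ρ , y<ρ′) → y≮ρ , λ y≮ρ′ → y≮ρ′ y<ρ′) meets)

  MeetsAt : (ℕ → Bool) → ℕ → Set (l ⊔ r)
  MeetsAt x m = Meets (Exceptions x) (rank (stem x m)) (rank (stem x (suc m)))

  siblings-compatible : ∀ {m u v} → AgreeBelow m u v → ¬ MeetsAt u m → ¬ MeetsAt v m →
                        Compatible (stem u (suc m)) (stem v (suc m))
  siblings-compatible {m} {u} {v} u≐v ¬meets-u ¬meets-v y p q with y <? rank (stem u m)
  ... | yes y<ρ = trans (sym (proj₂ (stem-⊆ {x = u} (λ _ → refl)) y y<ρ p))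
                        (proj₂ (stem-⊆ u≐v) y y<ρ q)
  ... | no y≮ρ = trans (stem-agrees-with-top u (suc m) y p (¬Meets⇒∉ ¬meets-u y≮ρ p))
                       (sym (stem-agrees-with-top v (suc m) y q (¬Meets⇒∉ ¬meets-v y≮ρ′ q)))
    where
    y≮ρ′ : ¬ y < rank (stem v m)
    y≮ρ′ = subst (λ ρ → ¬ y < ρ) (cong (rank ∘ e ∘ fin) (applyUpTo-cong u≐v)) y≮ρ

  branching-meets : ∀ {m u v} → AgreeBelow m u v → u m ≢ v m →
                    ¬ MeetsAt u m → MeetsAt v m
  branching-meets {m} {u} {v} u≐v um≢vm ¬meets-u
    with meets? (Exceptions v) (rank (stem v m)) (rank (stem v (suc m)))
  ... | yes meets-v = meets-v
  ... | no ¬meets-v with compatible⇒comparable (siblings-compatible u≐v ¬meets-u ¬meets-v)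
  ...   | inj₁ u⊆v = contradiction (e-reflect u⊆v) (applyUpTo-suc-⋢ u≐v um≢vm)
  ...   | inj₂ v⊆u = contradiction (e-reflect v⊆u) (applyUpTo-suc-⋢ (sym ∘ u≐v) (um≢vm ∘ sym))

  flipAt : ℕ → (ℕ → Bool) → ℕ → Bool
  flipAt m x i with i ℕ.≟ m
  ... | yes _ = not (x i)
  ... | no _  = x i

  flipAt-agree : ∀ {m x} → AgreeBelow m x (flipAt m x)
  flipAt-agree {m} {x} {i} i<m with i ℕ.≟ m
  ... | yes refl = contradiction i<m (ℕₚ.n≮n i)
  ... | no _     = refl

  flipAt-≢ : ∀ m x → x m ≢ flipAt m x m
  flipAt-≢ m x with m ℕ.≟ m
  ... | yes _   = not-¬ refl
  ... | no m≢m  = contradiction refl m≢m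

  next : ℕ → (ℕ → Bool) → ℕ → Bool
  next m x with meets? (Exceptions x) (rank (stem x m)) (rank (stem x (suc m)))
  ... | yes _ = x
  ... | no _  = flipAt m x

  next-spec : ∀ m x → (MeetsAt x m × next m x ≡ x) ⊎ (¬ MeetsAt x m × next m x ≡ flipAt m x)
  next-spec m x with meets? (Exceptions x) (rank (stem x m)) (rank (stem x (suc m)))
  ... | yes meets  = inj₁ (meets , refl)
  ... | no ¬meets  = inj₂ (¬meets , refl)

  next-agree : ∀ {m x} → AgreeBelow m x (next m x)
  next-agree {m} {x} i<m with next-spec m x
  ... | inj₁ (_ , next≡x)    = cong (λ z → z _) (sym next≡x)
  ... | inj₂ (_ , next≡flip) = trans (flipAt-agree i<m) (cong (λ z → z _) (sym next≡flip))

  approx : ℕ → ℕ → Bool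
  approx zero    = λ _ → false
  approx (suc m) = next m (approx m)

  limit : ℕ → Bool
  limit i = approx (suc i) i

  approx-agree-limit : ∀ m → AgreeBelow m (approx m) limit
  approx-agree-limit (suc m) {i} i<1+m with ℕₚ.m<1+n⇒m<n∨m≡n i<1+m
  ... | inj₁ i<m  = trans (sym (next-agree i<m)) (approx-agree-limit m i<m)
  ... | inj₂ refl = refl

  measure : ℕ → ℕ × ℕ
  measure m = countFrom (Exceptions limit) (rank (stem limit m))
            , countFrom (Exceptions (approx m)) (rank (stem (approx m) m))

  measure-descending : InfiniteDescendingSequence _<ₗₑₓ_ measure
  measure-descending m with next-spec m (approx m)
  ... | inj₁ (meets , next≡) =
    inj₂ ( countFrom-antitone (Exceptions limit) (stem-rank-mono limit m)
         , subst (λ x → countFrom (Exceptions x) (rank (stem x (suc m))) ℕ.< proj₂ (measure m)) (sym next≡)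
                 (countFrom-decreasing (Exceptions (approx m)) (stem-rank-mono (approx m) m) meets))
  ... | inj₂ (¬meets , next≡) =
    inj₁ (countFrom-decreasing (Exceptions limit) (stem-rank-mono limit m)
           (branching-meets (approx-agree-limit m) switched ¬meets))
    where
    switched : approx m m ≢ limit m
    switched eq = flipAt-≢ m (approx m) (trans eq (cong (λ z → z m) next≡))

  absurd : ⊥
  absurd = wellFounded⇒noDescendingSequence <ₗₑₓ-wellFounded measure measure-descending

mainTheorem1 : ∀ {l r a t : Level} {L : Set l} (_<_ : Rel L r) → IsStrictTotalOrder _≡_ _<_ →
    (A : Set a) (T : Functional.Node _<_ A → Set t) →
    Functional.Coherent _<_ A T → Functional.UncountableCof _<_ A T →
    ¬ Functional.EmbedsCantorTree _<_ A T
mainTheorem1 _<_ sto A T coh unc emb = NoCantorSubtree.absurd sto coh unc emb
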